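{- Let $s,t$ be positive integers and let $M$ be a matroid with the $(s,2s,t,2t)$-property. If $M$ has an $s$-echidna $(S_1,\dots,S_n)$ with $n\ge s+2t-1$, then $(S_1,\dots,S_n)$ is also a $t$-coechidna of $M$.
   Context: A matroid $M$ has the $(s,2s,t,2t)$-property if every $s$-element subset of $E(M)$ is contained in a $2s$-element circuit and every $t$-element subset of $E(M)$ is contained in a $2t$-element cocircuit. For a positive integer $k$, a $k$-echidna of order $n$ of $M$ is a partition $(S_1,\dots,S_n)$ of a subset of $E(M)$ such that $|S_i|=2$ for all $i$ and $\bigcup_{i\in I}S_i$ is a circuit of $M$ for every $k$-element $I\subseteq\{1,\dots,n\}$; it is a $k$-coechidna of $M$ if it is a $k$-echidna of $M^*$. -}

module Defs where

open import Data.Nat using (ℕ; zero; suc; _<_; _*_)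
open import Data.Bool using (Bool; true; false; if_then_else_)
open import Data.Vec using (_∷_)
open import Data.Fin using (Fin)
import Data.Fin as F
open import Data.Fin.Subset
open import Data.Product using (_×_; ∃)
open import Relation.Binary.PropositionalEquality using (_≡_; _≢_)
open import Relation.Nullary using (¬_)

record Matroid (m : ℕ) : Set₁ where
  field
    Indep     : Subset m → Set
    indep-∅   : Indep ⊥
    indep-⊆   : ∀ {I J} → Indep J → I ⊆ J → Indep I
    indep-aug : ∀ {I J} → Indep I → Indep J → ∣ I ∣ < ∣ J ∣ →
                ∃ λ e → e ∈ J × e ∉ I × Indep (I ∪ ⁅ e ⁆)
open Matroid public

module _ {m : ℕ} (M : Matroid m) where

  IsBasis : Subset m → Set
  IsBasis B = Indep M B × (∀ X → Indep M X → B ⊆ X → X ≡ B)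

  IsCircuit : Subset m → Set
  IsCircuit C = ¬ Indep M C × (∀ X → X ⊂ C → Indep M X)

  -- independent sets of the dual M*: subsets of complements of bases of M
  CoIndep : Subset m → Set
  CoIndep X = ∃ λ B → IsBasis B × X ⊆ ∁ B

  IsCocircuit : Subset m → Set
  IsCocircuit C = ¬ CoIndep C × (∀ X → X ⊂ C → CoIndep X)

  HasProperty : ℕ → ℕ → Set
  HasProperty s t =
    (∀ X → ∣ X ∣ ≡ s → ∃ λ C → IsCircuit C × X ⊆ C × ∣ C ∣ ≡ 2 * s) ×
    (∀ X → ∣ X ∣ ≡ t → ∃ λ C → IsCocircuit C × X ⊆ C × ∣ C ∣ ≡ 2 * t)

⋃[_]_ : ∀ {m n} → (Fin n → Subset m) → Subset n → Subset m
⋃[_]_ {n = zero} S I = ⊥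
⋃[_]_ {n = suc n} S (b ∷ I) =
  (if b then S F.zero else ⊥) ∪ (⋃[ (λ i → S (F.suc i)) ] I)

IsPairPartition : ∀ {m n} → (Fin n → Subset m) → Set
IsPairPartition {n = n} S =
  (∀ i → ∣ S i ∣ ≡ 2) × (∀ (i j : Fin n) → i ≢ j → Empty (S i ∩ S j))

module _ {m : ℕ} (M : Matroid m) where

  IsEchidna : (k : ℕ) → ∀ {n} → (Fin n → Subset m) → Set
  IsEchidna k {n} S =
    IsPairPartition S × (∀ (I : Subset n) → ∣ I ∣ ≡ k → IsCircuit M (⋃[ S ] I))

  -- k-echidna of M*: the unions are cocircuits of M
  IsCoechidna : (k : ℕ) → ∀ {n} → (Fin n → Subset m) → Set
  IsCoechidna k {n} S =
    IsPairPartition S × (∀ (I : Subset n) → ∣ I ∣ ≡ k → IsCocircuit M (⋃[ S ] I))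

-- Let y ∈ Sᵢ and let D be a cocircuit of size 2t meeting Sᵢ in x. If y ∉ D, then
-- at most 2t − 1 pairs meet D − x, and i is not among them; as n ≥ s + 2t − 1, the
-- index i extends to s indices avoiding them, whose pairs form a circuit meeting D in
-- x alone, against orthogonality of circuits and cocircuits. So a cocircuit of size
-- 2t contains every pair it meets. For t pairs, a t-set hitting each of them lies in
-- such a cocircuit by the (s,2s,t,2t)-property, which therefore is their union.

module Submission where

open import Defs
open import Data.Nat using (ℕ; zero; suc; _+_; _∸_; _*_; _≥_; _≤_; _<_; _≤?_; NonZero; z≤n; s≤s)
open import Data.Nat.Properties hiding (_≟_)
open import Data.Bool using (true; false)
open import Data.Fin using (Fin)
import Data.Fin as F
open import Data.Fin.Properties using (_≟_) renaming (suc-injective to Fin-suc-injective)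
open import Data.Fin.Subset
open import Data.Fin.Subset.Properties
open import Data.Vec using ([]; _∷_; here; there; tabulate)
open import Data.Vec.Properties using (lookup∘tabulate; []=⇒lookup; lookup⇒[]=)
open import Data.Product using (_×_; ∃; _,_; proj₁; proj₂)
open import Data.Sum using (inj₁; inj₂)
open import Data.Empty using (⊥-elim)
open import Function using (_∘_)
open import Relation.Binary.PropositionalEquality using (_≡_; _≢_; refl; sym; trans; subst; cong)
open import Relation.Nullary using (¬_; yes; no; does; contradiction)
open import Relation.Nullary.Decidable using (dec-true)
open import Relation.Unary using (Decidable)

x∈p─q⇒x∉q : ∀ {n} (p q : Subset n) {x} → x ∈ p ─ q → x ∉ q
x∈p─q⇒x∉q (_ ∷ p) (true ∷ q)  {F.zero}  ()           here
x∈p─q⇒x∉q (_ ∷ p) (_ ∷ q)     {F.suc x} (there x∈p─q) (there x∈q) = x∈p─q⇒x∉q p q x∈p─q x∈q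

∣p∪q∣≤∣p∣+∣q∣ : ∀ {n} (p q : Subset n) → ∣ p ∪ q ∣ ≤ ∣ p ∣ + ∣ q ∣
∣p∪q∣≤∣p∣+∣q∣ []          []          = z≤n
∣p∪q∣≤∣p∣+∣q∣ (true ∷ p)  (true ∷ q)  = s≤s (≤-trans (∣p∪q∣≤∣p∣+∣q∣ p q) (+-monoʳ-≤ ∣ p ∣ (n≤1+n ∣ q ∣)))
∣p∪q∣≤∣p∣+∣q∣ (true ∷ p)  (false ∷ q) = s≤s (∣p∪q∣≤∣p∣+∣q∣ p q)
∣p∪q∣≤∣p∣+∣q∣ (false ∷ p) (true ∷ q)  = ≤-trans (s≤s (∣p∪q∣≤∣p∣+∣q∣ p q)) (≤-reflexive (sym (+-suc ∣ p ∣ ∣ q ∣)))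
∣p∪q∣≤∣p∣+∣q∣ (false ∷ p) (false ∷ q) = ∣p∪q∣≤∣p∣+∣q∣ p q

∣p∪q∣≡∣p∣+∣q∣ : ∀ {n} (p q : Subset n) → Empty (p ∩ q) → ∣ p ∪ q ∣ ≡ ∣ p ∣ + ∣ q ∣
∣p∪q∣≡∣p∣+∣q∣ []          []          _     = refl
∣p∪q∣≡∣p∣+∣q∣ (true ∷ p)  (true ∷ q)  p∩q=∅ = contradiction (F.zero , here) p∩q=∅
∣p∪q∣≡∣p∣+∣q∣ (true ∷ p)  (false ∷ q) p∩q=∅ = cong suc (∣p∪q∣≡∣p∣+∣q∣ p q (drop-∷-Empty p∩q=∅))
∣p∪q∣≡∣p∣+∣q∣ (false ∷ p) (true ∷ q)  p∩q=∅ =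
  trans (cong suc (∣p∪q∣≡∣p∣+∣q∣ p q (drop-∷-Empty p∩q=∅))) (sym (+-suc ∣ p ∣ ∣ q ∣))
∣p∪q∣≡∣p∣+∣q∣ (false ∷ p) (false ∷ q) p∩q=∅ = ∣p∪q∣≡∣p∣+∣q∣ p q (drop-∷-Empty p∩q=∅)

module _ {n : ℕ} where

  p⊆q∧∣q∣≤∣p∣⇒p≡q : ∀ {p q : Subset n} → p ⊆ q → ∣ q ∣ ≤ ∣ p ∣ → p ≡ q
  p⊆q∧∣q∣≤∣p∣⇒p≡q {p} {q} p⊆q ∣q∣≤∣p∣ = ⊆-antisym p⊆q q⊆p
    where
    q⊆p : q ⊆ p
    q⊆p {x} x∈q with x ∈? p
    ... | yes x∈p = x∈p
    ... | no  x∉p = contradiction ∣q∣≤∣p∣ (<⇒≱ (p⊂q⇒∣p∣<∣q∣ (p⊆q , x , x∈q , x∉p)))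

  x∈p⇒⁅x⁆⊆p : ∀ {p : Subset n} {x} → x ∈ p → ⁅ x ⁆ ⊆ p
  x∈p⇒⁅x⁆⊆p {p} {x} x∈p y∈⁅x⁆ = subst (_∈ p) (sym (x∈⁅y⁆⇒x≡y x y∈⁅x⁆)) x∈p

  nonempty⇒0<∣p∣ : ∀ {p : Subset n} → Nonempty p → 0 < ∣ p ∣
  nonempty⇒0<∣p∣ {p} (x , x∈p) = subst (_≤ ∣ p ∣) (∣⁅x⁆∣≡1 x) (p⊆q⇒∣p∣≤∣q∣ (x∈p⇒⁅x⁆⊆p x∈p))

  ∣p∣≤1⇒x≡y : ∀ {p : Subset n} {x y} → ∣ p ∣ ≤ 1 → x ∈ p → y ∈ p → x ≡ y
  ∣p∣≤1⇒x≡y {p} {x} {y} ∣p∣≤1 x∈p y∈p with x ≟ y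
  ... | yes x≡y = x≡y
  ... | no  x≢y = contradiction ∣p∣≤1 (<⇒≱ (subst (_< ∣ p ∣) (∣⁅x⁆∣≡1 x) (p⊂q⇒∣p∣<∣q∣ ⁅x⁆⊂p)))
    where
    ⁅x⁆⊂p : ⁅ x ⁆ ⊂ p
    ⁅x⁆⊂p = x∈p⇒⁅x⁆⊆p x∈p , y , y∈p , x≢y⇒x∉⁅y⁆ (x≢y ∘ sym)

  0<∣p∣⇒nonempty : ∀ {p : Subset n} → 0 < ∣ p ∣ → Nonempty p
  0<∣p∣⇒nonempty {p} 0<∣p∣ with nonempty? p
  ... | yes p≠∅ = p≠∅
  ... | no  p=∅ = contradiction (trans (cong ∣_∣ (Empty-unique p=∅)) (∣⊥∣≡0 n)) (>⇒≢ 0<∣p∣)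

∃⊆-of-size : ∀ {n} k (p : Subset n) → k ≤ ∣ p ∣ → ∃ λ q → q ⊆ p × ∣ q ∣ ≡ k
∃⊆-of-size {n} zero p _ = ⊥ , ⊥⊆ , ∣⊥∣≡0 n
∃⊆-of-size (suc k) (true ∷ p) (s≤s k≤∣p∣) with ∃⊆-of-size k p k≤∣p∣
... | q , q⊆p , ∣q∣≡k = true ∷ q , s⊆s q⊆p , cong suc ∣q∣≡k
∃⊆-of-size (suc k) (false ∷ p) 1+k≤∣p∣ with ∃⊆-of-size (suc k) p 1+k≤∣p∣
... | q , q⊆p , ∣q∣≡k = false ∷ q , out⊆ q⊆p , ∣q∣≡k

∃⊆-of-size-∋ : ∀ {n} k {p : Subset n} {x} → x ∈ p → suc k ≤ ∣ p ∣ →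
               ∃ λ q → x ∈ q × q ⊆ p × ∣ q ∣ ≡ suc k
∃⊆-of-size-∋ k {true ∷ p} here (s≤s k≤∣p∣) with ∃⊆-of-size k p k≤∣p∣
... | q , q⊆p , ∣q∣≡k = true ∷ q , here , s⊆s q⊆p , cong suc ∣q∣≡k
∃⊆-of-size-∋ k {false ∷ p} (there x∈p) k<∣p∣ with ∃⊆-of-size-∋ k x∈p k<∣p∣
... | q , x∈q , q⊆p , ∣q∣≡1+k = false ∷ q , there x∈q , out⊆ q⊆p , ∣q∣≡1+k
∃⊆-of-size-∋ zero {true ∷ p} (there x∈p) _ with ∃⊆-of-size-∋ zero x∈p (nonempty⇒0<∣p∣ (_ , x∈p))
... | q , x∈q , q⊆p , ∣q∣≡1 = false ∷ q , there x∈q , out⊆ q⊆p , ∣q∣≡1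
∃⊆-of-size-∋ (suc k) {true ∷ p} (there x∈p) (s≤s k<∣p∣) with ∃⊆-of-size-∋ k x∈p k<∣p∣
... | q , x∈q , q⊆p , ∣q∣≡1+k = true ∷ q , there x∈q , s⊆s q⊆p , cong suc ∣q∣≡1+k

module _ {n} {P : Fin n → Set} (P? : Decidable P) where

  ∈-tabulate⁺ : ∀ {i} → P i → i ∈ tabulate (does ∘ P?)
  ∈-tabulate⁺ {i} Pi = lookup⇒[]= i _ (trans (lookup∘tabulate _ i) (dec-true (P? i) Pi))

  ∈-tabulate⁻ : ∀ {i} → i ∈ tabulate (does ∘ P?) → P i
  ∈-tabulate⁻ {i} i∈ with P? i | trans (sym (lookup∘tabulate (does ∘ P?) i)) ([]=⇒lookup i∈)
  ... | yes Pi | _ = Pi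
  ... | no  _  | ()

module _ {m : ℕ} where

  PairwiseDisjoint : ∀ {n} → (Fin n → Subset m) → Set
  PairwiseDisjoint {n} S = ∀ (i j : Fin n) → i ≢ j → Empty (S i ∩ S j)

  pairwiseDisjoint-⊆ : ∀ {n} {S P : Fin n → Subset m} →
                       PairwiseDisjoint S → (∀ i → P i ⊆ S i) → PairwiseDisjoint P
  pairwiseDisjoint-⊆ {P = P} disjoint P⊆S i j i≢j (x , x∈Pi∩Pj) with x∈p∩q⁻ (P i) (P j) x∈Pi∩Pj
  ... | x∈Pi , x∈Pj = disjoint i j i≢j (x , x∈p∩q⁺ (P⊆S i x∈Pi , P⊆S j x∈Pj))

  pairwiseDisjoint-tail : ∀ {n} {S : Fin (suc n) → Subset m} →
                         PairwiseDisjoint S → PairwiseDisjoint (S ∘ F.suc)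
  pairwiseDisjoint-tail disjoint i j i≢j = disjoint (F.suc i) (F.suc j) (i≢j ∘ Fin-suc-injective)

  ∈⋃⁻ : ∀ {n} (S : Fin n → Subset m) I {x} → x ∈ ⋃[ S ] I → ∃ λ i → i ∈ I × x ∈ S i
  ∈⋃⁻ S [] x∈⊥ = contradiction x∈⊥ ∉⊥
  ∈⋃⁻ {suc n} S (true ∷ I) x∈⋃ with x∈p∪q⁻ (S F.zero) _ x∈⋃
  ... | inj₁ x∈S₀ = F.zero , here , x∈S₀
  ... | inj₂ x∈⋃′ with ∈⋃⁻ (S ∘ F.suc) I x∈⋃′
  ... | i , i∈I , x∈Si = F.suc i , there i∈I , x∈Si
  ∈⋃⁻ {suc n} S (false ∷ I) x∈⋃ with ∈⋃⁻ (S ∘ F.suc) I (subst (_ ∈_) (∪-identityˡ (⋃[ S ∘ F.suc ] I)) x∈⋃)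
  ... | i , i∈I , x∈Si = F.suc i , there i∈I , x∈Si

  ∈⋃⁺ : ∀ {n} (S : Fin n → Subset m) I {i x} → i ∈ I → x ∈ S i → x ∈ ⋃[ S ] I
  ∈⋃⁺ S (true ∷ I)  here        x∈Si = p⊆p∪q _ x∈Si
  ∈⋃⁺ S (true ∷ I)  (there i∈I) x∈Si = q⊆p∪q (S F.zero) _ (∈⋃⁺ (S ∘ F.suc) I i∈I x∈Si)
  ∈⋃⁺ S (false ∷ I) (there i∈I) x∈Si = q⊆p∪q ⊥ _ (∈⋃⁺ (S ∘ F.suc) I i∈I x∈Si)

  ∣⋃∣≤ : ∀ {n} (S : Fin n → Subset m) I k → (∀ {i} → i ∈ I → ∣ S i ∣ ≤ k) →
         ∣ ⋃[ S ] I ∣ ≤ k * ∣ I ∣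
  ∣⋃∣≤ S [] k _ = ≤-reflexive (trans (∣⊥∣≡0 m) (sym (*-zeroʳ k)))
  ∣⋃∣≤ S (true ∷ I) k ∣S∣≤k = begin
    ∣ S F.zero ∪ ⋃[ S ∘ F.suc ] I ∣       ≤⟨ ∣p∪q∣≤∣p∣+∣q∣ (S F.zero) _ ⟩
    ∣ S F.zero ∣ + ∣ ⋃[ S ∘ F.suc ] I ∣   ≤⟨ +-mono-≤ (∣S∣≤k here) (∣⋃∣≤ (S ∘ F.suc) I k (∣S∣≤k ∘ there)) ⟩
    k + k * ∣ I ∣                         ≡⟨ *-suc k ∣ I ∣ ⟨
    k * suc ∣ I ∣                         ∎
    where open ≤-Reasoning
  ∣⋃∣≤ S (false ∷ I) k ∣S∣≤k =
    subst (λ U → ∣ U ∣ ≤ k * ∣ I ∣) (sym (∪-identityˡ (⋃[ S ∘ F.suc ] I))) (∣⋃∣≤ (S ∘ F.suc) I k (∣S∣≤k ∘ there))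

  ∣⋃∣≥ : ∀ {n} (S : Fin n → Subset m) I k → PairwiseDisjoint S → (∀ {i} → i ∈ I → k ≤ ∣ S i ∣) →
         k * ∣ I ∣ ≤ ∣ ⋃[ S ] I ∣
  ∣⋃∣≥ S [] k _ _ = subst (_≤ ∣ ⊥ {m} ∣) (sym (*-zeroʳ k)) z≤n
  ∣⋃∣≥ S (true ∷ I) k disjoint k≤∣S∣ = begin
    k * suc ∣ I ∣                         ≡⟨ *-suc k ∣ I ∣ ⟩
    k + k * ∣ I ∣                         ≤⟨ +-mono-≤ (k≤∣S∣ here) (∣⋃∣≥ (S ∘ F.suc) I k (pairwiseDisjoint-tail disjoint) (k≤∣S∣ ∘ there)) ⟩
    ∣ S F.zero ∣ + ∣ ⋃[ S ∘ F.suc ] I ∣   ≡⟨ ∣p∪q∣≡∣p∣+∣q∣ (S F.zero) _ S₀∩⋃=∅ ⟨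
    ∣ S F.zero ∪ ⋃[ S ∘ F.suc ] I ∣       ∎
    where
    open ≤-Reasoning
    S₀∩⋃=∅ : Empty (S F.zero ∩ ⋃[ S ∘ F.suc ] I)
    S₀∩⋃=∅ (x , x∈∩) with x∈p∩q⁻ (S F.zero) _ x∈∩
    ... | x∈S₀ , x∈⋃ with ∈⋃⁻ (S ∘ F.suc) I x∈⋃
    ... | i , _ , x∈Si = disjoint F.zero (F.suc i) (λ ()) (x , x∈p∩q⁺ (x∈S₀ , x∈Si))
  ∣⋃∣≥ S (false ∷ I) k disjoint k≤∣S∣ =
    subst (λ U → k * ∣ I ∣ ≤ ∣ U ∣) (sym (∪-identityˡ (⋃[ S ∘ F.suc ] I)))
      (∣⋃∣≥ (S ∘ F.suc) I k (pairwiseDisjoint-tail disjoint) (k≤∣S∣ ∘ there))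

module _ {m n : ℕ} (S : Fin n → Subset m) where

  indicesMeeting : Subset m → Subset n
  indicesMeeting A = tabulate (does ∘ λ j → nonempty? (S j ∩ A))

  ∈indicesMeeting⁺ : ∀ {A j} → Nonempty (S j ∩ A) → j ∈ indicesMeeting A
  ∈indicesMeeting⁺ {A} = ∈-tabulate⁺ (λ j → nonempty? (S j ∩ A))

  ∈indicesMeeting⁻ : ∀ {A j} → j ∈ indicesMeeting A → Nonempty (S j ∩ A)
  ∈indicesMeeting⁻ {A} = ∈-tabulate⁻ (λ j → nonempty? (S j ∩ A))

  ∣indicesMeeting∣≤ : PairwiseDisjoint S → ∀ A → ∣ indicesMeeting A ∣ ≤ ∣ A ∣
  ∣indicesMeeting∣≤ disjoint A = begin
    ∣ K ∣                    ≡⟨ *-identityˡ ∣ K ∣ ⟨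
    1 * ∣ K ∣                ≤⟨ ∣⋃∣≥ S∩A K 1 (pairwiseDisjoint-⊆ disjoint (λ j → p∩q⊆p (S j) A))
                                    (nonempty⇒0<∣p∣ ∘ ∈indicesMeeting⁻) ⟩
    ∣ ⋃[ S∩A ] K ∣           ≤⟨ p⊆q⇒∣p∣≤∣q∣ ⋃⊆A ⟩
    ∣ A ∣                    ∎
    where
    open ≤-Reasoning
    K : Subset n
    K = indicesMeeting A
    S∩A : Fin n → Subset m
    S∩A j = S j ∩ A
    ⋃⊆A : ⋃[ S∩A ] K ⊆ A
    ⋃⊆A x∈⋃ with ∈⋃⁻ S∩A K x∈⋃
    ... | j , _ , x∈S∩A = p∩q⊆q (S j) A x∈S∩A

  transversal : PairwiseDisjoint S → (∀ i → Nonempty (S i)) → ∀ I →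
                ∃ λ T → ∣ T ∣ ≡ ∣ I ∣ × (∀ {i} → i ∈ I → Nonempty (S i ∩ T))
  transversal disjoint nonempty I = ⋃[ P ] I , ∣T∣≡∣I∣ , meets
    where
    P : Fin n → Subset m
    P i = ⁅ proj₁ (nonempty i) ⁆
    ∣P∣≡1 : ∀ {i} → ∣ P i ∣ ≡ 1
    ∣P∣≡1 {i} = ∣⁅x⁆∣≡1 (proj₁ (nonempty i))
    P-disjoint : PairwiseDisjoint P
    P-disjoint = pairwiseDisjoint-⊆ disjoint (λ i → x∈p⇒⁅x⁆⊆p (proj₂ (nonempty i)))
    ∣T∣≡∣I∣ : ∣ ⋃[ P ] I ∣ ≡ ∣ I ∣
    ∣T∣≡∣I∣ = trans (≤-antisym (∣⋃∣≤ P I 1 (λ _ → ≤-reflexive ∣P∣≡1))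
                                (∣⋃∣≥ P I 1 P-disjoint (λ _ → ≤-reflexive (sym ∣P∣≡1))))
                     (*-identityˡ ∣ I ∣)
    meets : ∀ {i} → i ∈ I → Nonempty (S i ∩ ⋃[ P ] I)
    meets {i} i∈I = proj₁ (nonempty i) , x∈p∩q⁺ (proj₂ (nonempty i) , ∈⋃⁺ P I i∈I (x∈⁅x⁆ _))

module _ {m : ℕ} (M : Matroid m) where

  ∣indep∣≤∣basis∣ : ∀ {B I} → IsBasis M B → Indep M I → ∣ I ∣ ≤ ∣ B ∣
  ∣indep∣≤∣basis∣ {B} (B-indep , B-max) I-indep = ≮⇒≥ ∣B∣≮∣I∣
    where
    ∣B∣≮∣I∣ : ¬ ∣ B ∣ < _
    ∣B∣≮∣I∣ ∣B∣<∣I∣ with indep-aug M B-indep I-indep ∣B∣<∣I∣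
    ... | e , _ , e∉B , B+e-indep =
      e∉B (subst (e ∈_) (B-max _ B+e-indep (p⊆p∪q _)) (q⊆p∪q B _ (x∈⁅x⁆ e)))

  indep∧∣B∣≤∣J∣⇒basis : ∀ {B J} → IsBasis M B → Indep M J → ∣ B ∣ ≤ ∣ J ∣ → IsBasis M J
  indep∧∣B∣≤∣J∣⇒basis B-basis J-indep ∣B∣≤∣J∣ = J-indep , λ X X-indep J⊆X →
    sym (p⊆q∧∣q∣≤∣p∣⇒p≡q J⊆X (≤-trans (∣indep∣≤∣basis∣ B-basis X-indep) ∣B∣≤∣J∣))

  extend-to-basis : ∀ {J B} → Indep M J → IsBasis M B →
                    ∃ λ B′ → IsBasis M B′ × J ⊆ B′ × B′ ⊆ J ∪ B
  extend-to-basis {J} {B} J-indep B-basis =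
    extend ∣ B ∣ J J-indep (m≤m+n ∣ B ∣ ∣ J ∣) ⊆-refl (p⊆p∪q B)
    where
    extend : ∀ fuel J′ → Indep M J′ → ∣ B ∣ ≤ fuel + ∣ J′ ∣ → J ⊆ J′ → J′ ⊆ J ∪ B →
             ∃ λ B′ → IsBasis M B′ × J ⊆ B′ × B′ ⊆ J ∪ B
    extend fuel J′ J′-indep _ J⊆J′ J′⊆J∪B with ∣ B ∣ ≤? ∣ J′ ∣
    ... | yes ∣B∣≤∣J′∣ = J′ , indep∧∣B∣≤∣J∣⇒basis B-basis J′-indep ∣B∣≤∣J′∣ , J⊆J′ , J′⊆J∪B
    extend zero J′ _ ∣B∣≤∣J′∣ _ _ | no ∣B∣≰∣J′∣ = contradiction ∣B∣≤∣J′∣ ∣B∣≰∣J′∣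
    extend (suc fuel) J′ J′-indep bound J⊆J′ J′⊆J∪B | no ∣B∣≰∣J′∣
      with indep-aug M J′-indep (proj₁ B-basis) (≰⇒> ∣B∣≰∣J′∣)
    ... | f , f∈B , f∉J′ , J′+f-indep =
      extend fuel (J′ ∪ ⁅ f ⁆) J′+f-indep bound′ (⊆-trans J⊆J′ (p⊆p∪q _)) J′+f⊆J∪B
      where
      bound′ : ∣ B ∣ ≤ fuel + ∣ J′ ∪ ⁅ f ⁆ ∣
      bound′ = ≤-trans bound (≤-trans (≤-reflexive (sym (+-suc fuel ∣ J′ ∣)))
                 (+-monoʳ-≤ fuel (p⊂q⇒∣p∣<∣q∣ (p⊆p∪q _ , f , q⊆p∪q J′ _ (x∈⁅x⁆ f) , f∉J′))))
      J′+f⊆J∪B : J′ ∪ ⁅ f ⁆ ⊆ J ∪ B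
      J′+f⊆J∪B x∈J′+f with x∈p∪q⁻ J′ _ x∈J′+f
      ... | inj₁ x∈J′  = J′⊆J∪B x∈J′
      ... | inj₂ x∈⁅f⁆ = q⊆p∪q J B (subst (_∈ B) (sym (x∈⁅y⁆⇒x≡y f x∈⁅f⁆)) f∈B)

  -- B′ extends C − x inside (C − x) ∪ B for a basis B avoiding D − x; it misses x
  -- since C is dependent, hence misses all of D, making D coindependent.
  circuit∩cocircuit≢⁅x⁆ : ∀ {C D x} → IsCircuit M C → IsCocircuit M D → x ∈ C → x ∈ D →
                          ¬ (∀ {z} → z ∈ C → z ∈ D → z ≡ x)
  circuit∩cocircuit≢⁅x⁆ {C} {D} {x} (C-dep , C-min) (D-dep , D-min) x∈C x∈D C∩D⊆⁅x⁆
    with D-min (D - x) (x∈p⇒p-x⊂p x∈D)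
  ... | B , B-basis , D-x⊆∁B with extend-to-basis (C-min (C - x) (x∈p⇒p-x⊂p x∈C)) B-basis
  ... | B′ , B′-basis , C-x⊆B′ , B′⊆C-x∪B = D-dep (B′ , B′-basis , λ z∈D → x∉p⇒x∈∁p (D∩B′=∅ z∈D))
    where
    x∉B′ : x ∉ B′
    x∉B′ x∈B′ = C-dep (indep-⊆ M (proj₁ B′-basis) C⊆B′)
      where
      C⊆B′ : C ⊆ B′
      C⊆B′ {z} z∈C with z ≟ x
      ... | yes refl = x∈B′
      ... | no  z≢x  = C-x⊆B′ (x∈p∧x≢y⇒x∈p-y z∈C z≢x)
    D∩B′=∅ : ∀ {z} → z ∈ D → z ∉ B′
    D∩B′=∅ {z} z∈D z∈B′ with z ≟ x
    ... | yes refl = x∉B′ z∈B′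
    ... | no  z≢x with x∈p∪q⁻ (C - x) B (B′⊆C-x∪B z∈B′)
    ...   | inj₁ z∈C-x = z≢x (C∩D⊆⁅x⁆ (p─q⊆p C _ z∈C-x) z∈D)
    ...   | inj₂ z∈B   = x∈p⇒x∉∁p z∈B (D-x⊆∁B (x∈p∧x≢y⇒x∈p-y z∈D z≢x))

  cocircuit-meeting-pair⊇it : ∀ {k n} {S : Fin n → Subset m} → IsEchidna M (suc k) S →
                              ∀ {D i x} → IsCocircuit M D → k + ∣ D ∣ ≤ n →
                              x ∈ S i → x ∈ D → S i ⊆ D
  cocircuit-meeting-pair⊇it {k} {n} {S} ((∣S∣≡2 , disjoint) , circuits) {D} {i} {x}
                            D-cocircuit bound x∈Sᵢ x∈D {y} y∈Sᵢ with y ∈? D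
  ... | yes y∈D = y∈D
  ... | no  y∉D with ∃⊆-of-size-∋ k (x∉p⇒x∈∁p i∉K) 1+k≤∣∁K∣
    where
    Sᵢ∩D⊆⁅x⁆ : ∀ {z} → z ∈ S i → z ∈ D → z ≡ x
    Sᵢ∩D⊆⁅x⁆ z∈Sᵢ z∈D = ∣p∣≤1⇒x≡y ∣Sᵢ∩D∣≤1 (x∈p∩q⁺ (z∈Sᵢ , z∈D)) (x∈p∩q⁺ (x∈Sᵢ , x∈D))
      where
      ∣Sᵢ∩D∣≤1 : ∣ S i ∩ D ∣ ≤ 1
      ∣Sᵢ∩D∣≤1 = ≤-pred (≤-trans (p⊂q⇒∣p∣<∣q∣ (p∩q⊆p (S i) D , y , y∈Sᵢ , y∉D ∘ proj₂ ∘ x∈p∩q⁻ (S i) D))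
                                 (≤-reflexive (∣S∣≡2 i)))
    K : Subset n
    K = indicesMeeting S (D - x)
    i∉K : i ∉ K
    i∉K i∈K with ∈indicesMeeting⁻ S i∈K
    ... | z , z∈Sᵢ∩D-x with x∈p∩q⁻ (S i) (D - x) z∈Sᵢ∩D-x
    ... | z∈Sᵢ , z∈D-x = x∈p─q⇒x∉q D ⁅ x ⁆ z∈D-x
                           (subst (_∈ ⁅ x ⁆) (sym (Sᵢ∩D⊆⁅x⁆ z∈Sᵢ (p─q⊆p D _ z∈D-x))) (x∈⁅x⁆ x))
    1+k≤∣∁K∣ : suc k ≤ ∣ ∁ K ∣
    1+k≤∣∁K∣ = subst (suc k ≤_) (sym (∣∁p∣≡n∸∣p∣ K)) (m+n≤o⇒m≤o∸n (suc k) (begin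
      suc k + ∣ K ∣   ≡⟨ +-suc k ∣ K ∣ ⟨
      k + suc ∣ K ∣   ≤⟨ +-monoʳ-≤ k (≤-<-trans (∣indicesMeeting∣≤ S disjoint (D - x)) (x∈p⇒∣p-x∣<∣p∣ x∈D)) ⟩
      k + ∣ D ∣       ≤⟨ bound ⟩
      n               ∎))
      where open ≤-Reasoning
  ... | J , i∈J , J⊆∁K , ∣J∣≡1+k =
    ⊥-elim (circuit∩cocircuit≢⁅x⁆ (circuits J ∣J∣≡1+k) D-cocircuit (∈⋃⁺ S J i∈J x∈Sᵢ) x∈D C∩D⊆⁅x⁆)
    where
    C∩D⊆⁅x⁆ : ∀ {z} → z ∈ ⋃[ S ] J → z ∈ D → z ≡ x
    C∩D⊆⁅x⁆ {z} z∈C z∈D with z ≟ x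
    ... | yes z≡x = z≡x
    ... | no  z≢x with ∈⋃⁻ S J z∈C
    ...   | j , j∈J , z∈Sⱼ = contradiction (∈indicesMeeting⁺ S (z , x∈p∩q⁺ (z∈Sⱼ , x∈p∧x≢y⇒x∈p-y z∈D z≢x)))
                                          (x∈∁p⇒x∉p (J⊆∁K j∈J))

lemma3p1 : (s t : ℕ) → .{{NonZero s}} → .{{NonZero t}} →
           {m : ℕ} (M : Matroid m) → HasProperty M s t →
           {n : ℕ} (S : Fin n → Subset m) → IsEchidna M s S →
           n ≥ s + 2 * t ∸ 1 → IsCoechidna M t S
-- With s = suc s′ the hypothesis n ≥ s + 2t ∸ 1 computes to s′ + 2t ≤ n.
lemma3p1 (suc s) t M (_ , t-set⊆cocircuit) S echidna@(partition@(∣S∣≡2 , disjoint) , _) s+2t≤n =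
  partition , cocircuit
  where
  S-nonempty : ∀ i → Nonempty (S i)
  S-nonempty i = 0<∣p∣⇒nonempty (subst (0 <_) (sym (∣S∣≡2 i)) (s≤s z≤n))

  cocircuit : ∀ I → ∣ I ∣ ≡ t → IsCocircuit M (⋃[ S ] I)
  cocircuit I ∣I∣≡t with transversal S disjoint S-nonempty I
  ... | T , ∣T∣≡∣I∣ , T-meets with t-set⊆cocircuit T (trans ∣T∣≡∣I∣ ∣I∣≡t)
  ... | D , D-cocircuit , T⊆D , ∣D∣≡2t =
    subst (IsCocircuit M) (sym (p⊆q∧∣q∣≤∣p∣⇒p≡q ⋃⊆D ∣D∣≤∣⋃∣)) D-cocircuit
    where
    ⋃⊆D : ⋃[ S ] I ⊆ D
    ⋃⊆D z∈⋃ with ∈⋃⁻ S I z∈⋃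
    ... | i , i∈I , z∈Sᵢ with T-meets i∈I
    ... | x , x∈Sᵢ∩T with x∈p∩q⁻ (S i) T x∈Sᵢ∩T
    ... | x∈Sᵢ , x∈T = cocircuit-meeting-pair⊇it M echidna D-cocircuit
                         (subst (λ d → s + d ≤ _) (sym ∣D∣≡2t) s+2t≤n) x∈Sᵢ (T⊆D x∈T) z∈Sᵢ
    ∣D∣≤∣⋃∣ : ∣ D ∣ ≤ ∣ ⋃[ S ] I ∣
    ∣D∣≤∣⋃∣ = subst (_≤ ∣ ⋃[ S ] I ∣) (trans (cong (2 *_) ∣I∣≡t) (sym ∣D∣≡2t))
                (∣⋃∣≥ S I 2 disjoint (λ {i} _ → ≤-reflexive (sym (∣S∣≡2 i))))
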